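{- Let $\phi$ be a letter-injective morphism such that $\phi(\ell)$ is square-free for every letter $\ell\in\mathbb{N}$. Suppose $w$ is a word such that $\phi(w)$ contains (an occurrence of) a square $yy$ for which the following three properties hold: (1) each half of the square contains at least one whole chunk; (2) the two halves of the square have the same chunk decomposition; (3) if either half has a partial chunk, then either their initial partial chunks or their final partial chunks come from the same letter of $w$. Then $w$ contains a square.
   Context: Words are over the alphabet $\mathbb{N}=\{0,1,2,\dots\}$. A square is a nonempty word $yy$. A morphism $\phi$ on $\mathbb{N}^*\cup\mathbb{N}^\omega$ is letter-injective if $\phi(k)=\phi(\ell)$ implies $k=\ell$ for letters $k,\ell$. For a word $w=w_0w_1w_2\cdots$, write $\phi(w)=[\phi(w_0)][\phi(w_1)][\phi(w_2)]\cdots$; each block $\phi(w_i)$ (at its position in $\phi(w)$) is a chunk, more precisely a $w_i$-chunk, and the chunk is said to come from the letter $w_i$. For a fixed occurrence of a factor $v$ of $\phi(w)$, the chunks lying entirely inside the occurrence are its whole chunks; if the occurrence starts strictly inside a chunk, the part of that chunk inside the occurrence is its initial partial chunk, and if it ends strictly inside a chunk, the part of that chunk inside the occurrence is its final partial chunk; a partial chunk comes from the letter its chunk comes from. Two (possibly partial) chunks come from the same letter if the letters of $w$ they come from are equal. Two occurrences of the same word $v$ in $\phi(w)$ have the same chunk decomposition if every whole chunk in one occurrence corresponds (at the same relative position within the occurrence) to a whole chunk in the other occurrence, and the two corresponding chunks come from the same letter. -}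

module Defs where

open import Data.Nat using (ℕ; zero; suc; _+_; _∸_; _≤_; _<_)
open import Data.List using (List; []; _∷_; _++_; length)
open import Data.Maybe using (Maybe; just; nothing; maybe)
open import Data.Product using (Σ; ∃; ∃-syntax; _×_; _,_)
open import Data.Sum using (_⊎_)
open import Relation.Nullary using (¬_)
open import Relation.Binary.PropositionalEquality using (_≡_)

data Word : Set where
  fin : List ℕ → Word
  inf : (ℕ → ℕ) → Word

at : List ℕ → ℕ → Maybe ℕ
at []       _       = nothing
at (x ∷ xs) zero    = just x
at (x ∷ xs) (suc i) = at xs i

letterAt : Word → ℕ → Maybe ℕ
letterAt (fin xs) i = at xs i
letterAt (inf f)  i = just (f i)

-- A morphism on ℕ* ∪ ℕ^ω is determined by the images of letters.
Morphism : Set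
Morphism = ℕ → List ℕ

LetterInjective : Morphism → Set
LetterInjective φ = ∀ k ℓ → φ k ≡ φ ℓ → k ≡ ℓ

SquareFree : List ℕ → Set
SquareFree x = ¬ (∃[ u ] ∃[ y ] ∃[ v ] (0 < length y × x ≡ u ++ (y ++ (y ++ v))))

ContainsSquare : Word → Set
ContainsSquare w = ∃[ i ] ∃[ n ] (0 < n × (∀ k → k < n →
  ∃[ c ] (letterAt w (i + k) ≡ just c × letterAt w (i + n + k) ≡ just c)))

-- The chunk φ(w_i) (empty if i is not a position of w).
chunk : Morphism → Word → ℕ → List ℕ
chunk φ w i = maybe φ [] (letterAt w i)

pos : Morphism → Word → ℕ → ℕ
pos φ w zero    = 0
pos φ w (suc i) = pos φ w i + length (chunk φ w i)

ImgAt : Morphism → Word → ℕ → ℕ → Set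
ImgAt φ w p c = ∃[ i ] ∃[ ℓ ] (letterAt w i ≡ just ℓ × pos φ w i ≤ p
  × at (φ ℓ) (p ∸ pos φ w i) ≡ just c)

SquareOcc : Morphism → Word → ℕ → ℕ → Set
SquareOcc φ w s m = 0 < m × (∀ k → k < m →
  ∃[ c ] (ImgAt φ w (s + k) c × ImgAt φ w (s + m + k) c))

-- For the occurrence occupying positions [a , b) of φ(w):
-- the i-th chunk (an ℓ-chunk) is a whole chunk of the occurrence
WholeChunk : Morphism → Word → ℕ → ℕ → ℕ → ℕ → Set
WholeChunk φ w a b i ℓ = letterAt w i ≡ just ℓ × a ≤ pos φ w i × pos φ w (suc i) ≤ b

InitialPartial : Morphism → Word → ℕ → ℕ → ℕ → ℕ → Set
InitialPartial φ w a b i ℓ = letterAt w i ≡ just ℓ × pos φ w i < a × a < pos φ w (suc i)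

FinalPartial : Morphism → Word → ℕ → ℕ → ℕ → ℕ → Set
FinalPartial φ w a b i ℓ = letterAt w i ≡ just ℓ × pos φ w i < b × b < pos φ w (suc i)

HasPartial : Morphism → Word → ℕ → ℕ → Set
HasPartial φ w a b = ∃[ i ] ∃[ ℓ ] (InitialPartial φ w a b i ℓ ⊎ FinalPartial φ w a b i ℓ)

HasWholeChunk : Morphism → Word → ℕ → ℕ → Set
HasWholeChunk φ w a b = ∃[ i ] ∃[ ℓ ] WholeChunk φ w a b i ℓ

SameChunkDecomposition : Morphism → Word → ℕ → ℕ → ℕ → Set
SameChunkDecomposition φ w a a' n =
  (∀ i ℓ → WholeChunk φ w a (a + n) i ℓ →
     ∃[ i' ] (WholeChunk φ w a' (a' + n) i' ℓ × pos φ w i' ∸ a' ≡ pos φ w i ∸ a))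
  × (∀ i' ℓ → WholeChunk φ w a' (a' + n) i' ℓ →
     ∃[ i ] (WholeChunk φ w a (a + n) i ℓ × pos φ w i ∸ a ≡ pos φ w i' ∸ a'))

InitialPartialsSameLetter : Morphism → Word → ℕ → ℕ → ℕ → Set
InitialPartialsSameLetter φ w a a' n = ∃[ i ] ∃[ i' ] ∃[ ℓ ]
  (InitialPartial φ w a (a + n) i ℓ × InitialPartial φ w a' (a' + n) i' ℓ)

FinalPartialsSameLetter : Morphism → Word → ℕ → ℕ → ℕ → Set
FinalPartialsSameLetter φ w a a' n = ∃[ i ] ∃[ i' ] ∃[ ℓ ]
  (FinalPartial φ w a (a + n) i ℓ × FinalPartial φ w a' (a' + n) i' ℓ)

-- If chunk b comes from the same letter as chunk a and starts m positions later, and every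
-- chunk strictly between a and b also reappears m positions later, then walking right from a
-- shows that chunk b + k comes from the same letter as chunk a + k for all k < b − a, so w has
-- the square w[a, b) w[b, 2b − a). The walk can only go wrong at an empty chunk, which shares
-- its starting position with its successor; but letter-injectivity allows at most one letter
-- with empty image, and every such failure produces two equal adjacent letters of w. The
-- hypotheses provide the pair (a, b): the same chunk decomposition repeats the whole chunks of
-- the first half, and the chunk containing the midpoint of the square is either whole, giving b
-- directly, or partial, where hypothesis (3) pins down the partial chunks at both ends.
module Submission where

open import Defs
open import Data.Nat using (ℕ; zero; suc; _+_; _∸_; _≤_; _<_; z≤n; s≤s; _<?_)
open import Data.Nat.Properties
open import Algebra.Properties.CommutativeSemigroup +-commutativeSemigroup using (xy∙z≈xz∙y)
open import Data.List using (List; []; _∷_; length)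
open import Data.Maybe using (just; maybe′)
open import Data.Maybe.Properties using (just-injective)
open import Data.Product using (∃; ∃-syntax; _×_; _,_; proj₁; proj₂; map₂)
open import Data.Sum using (_⊎_; inj₁; inj₂; [_,_]′)
open import Relation.Nullary using (yes; no; contradiction)
open import Relation.Binary.Definitions using (Tri; tri<; tri≈; tri>)
open import Relation.Binary.PropositionalEquality

at-≤ : ∀ xs {i j ℓ} → at xs j ≡ just ℓ → i ≤ j → ∃[ k ] at xs i ≡ just k
at-≤ (x ∷ xs) {zero}  _ _ = x , refl
at-≤ (x ∷ xs) {suc i} {suc j} e (s≤s i≤j) = at-≤ xs e i≤j

at⇒<length : ∀ xs {i c} → at xs i ≡ just c → i < length xs
at⇒<length (x ∷ xs) {zero}  _ = s≤s z≤n
at⇒<length (x ∷ xs) {suc i} e = s≤s (at⇒<length xs e)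

length≡0⇒[] : (xs : List ℕ) → length xs ≡ 0 → xs ≡ []
length≡0⇒[] [] _ = refl

letterAt-≤ : ∀ w {i j ℓ} → letterAt w j ≡ just ℓ → i ≤ j → ∃[ k ] letterAt w i ≡ just k
letterAt-≤ (fin xs) e i≤j = at-≤ xs e i≤j
letterAt-≤ (inf f) {i} _ _ = f i , refl

same-offset⇒shifted : ∀ {s m x y} → s ≤ x → s + m ≤ y → y ∸ (s + m) ≡ x ∸ s → y ≡ x + m
same-offset⇒shifted {s} {m} {x} {y} s≤x s+m≤y offsets = begin
  y                     ≡⟨ m∸n+n≡m s+m≤y ⟨
  y ∸ (s + m) + (s + m) ≡⟨ cong (_+ (s + m)) offsets ⟩
  x ∸ s + (s + m)       ≡⟨ +-assoc (x ∸ s) s m ⟨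
  x ∸ s + s + m         ≡⟨ cong (_+ m) (m∸n+n≡m s≤x) ⟩
  x + m                 ∎
  where open ≡-Reasoning

module Chunks (φ : Morphism) (w : Word) where

  P : ℕ → ℕ
  P = pos φ w

  SameLetter : ℕ → ℕ → Set
  SameLetter i j = ∃[ ℓ ] (letterAt w i ≡ just ℓ × letterAt w j ≡ just ℓ)

  same-letter-sym : ∀ {i j} → SameLetter i j → SameLetter j i
  same-letter-sym (ℓ , ei , ej) = ℓ , ej , ei

  same-letter-trans : ∀ {i j k} → SameLetter i j → SameLetter j k → SameLetter i k
  same-letter-trans (ℓ , ei , ej) (ℓ′ , ej′ , ek) =
    ℓ , ei , subst (λ c → letterAt w _ ≡ just c) (just-injective (trans (sym ej′) ej)) ek

  same-letter-suc⇒square : ∀ {i} → SameLetter i (suc i) → ContainsSquare w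
  same-letter-suc⇒square {i} (ℓ , ei , ei+1) = i , 1 , s≤s z≤n , λ where
    zero _ → ℓ , subst (λ j → letterAt w j ≡ just ℓ) (sym (+-identityʳ i)) ei
               , subst (λ j → letterAt w j ≡ just ℓ) (sym (trans (+-identityʳ (i + 1)) (+-comm i 1))) ei+1
    (suc _) (s≤s ())

  pos-suc : ∀ {i ℓ} → letterAt w i ≡ just ℓ → P (suc i) ≡ P i + length (φ ℓ)
  pos-suc {i} e = cong (λ c → P i + length (maybe′ φ [] c)) e

  pos-mono : ∀ {i j} → i ≤ j → P i ≤ P j
  pos-mono {j = zero} z≤n = ≤-refl
  pos-mono {j = suc j} i≤1+j with m≤n⇒m<n∨m≡n i≤1+j
  ... | inj₁ i<1+j = ≤-trans (pos-mono (≤-pred i<1+j)) (m≤m+n (P j) _)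
  ... | inj₂ refl = ≤-refl

  pos-cancel-< : ∀ {i j} → P i < P j → i < j
  pos-cancel-< {i} {j} Pi<Pj with i <? j
  ... | yes i<j = i<j
  ... | no i≮j = contradiction (pos-mono (≮⇒≥ i≮j)) (<⇒≱ Pi<Pj)

  empty-image : ∀ {i j ℓ} → letterAt w j ≡ just ℓ → i ≤ j → P (suc j) ≤ P i → length (φ ℓ) ≡ 0
  empty-image {i} {j} {ℓ} e i≤j stall = n≤0⇒n≡0 (+-cancelˡ-≤ (P j) _ 0 (begin
    P j + length (φ ℓ) ≡⟨ pos-suc e ⟨
    P (suc j)          ≤⟨ stall ⟩
    P i                ≤⟨ pos-mono i≤j ⟩
    P j                ≡⟨ +-identityʳ (P j) ⟨
    P j + 0            ∎))
    where open ≤-Reasoning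

  covering-chunk : ∀ {p c} → ImgAt φ w p c → ∃[ i ] ∃[ ℓ ] (letterAt w i ≡ just ℓ × P i ≤ p × p < P (suc i))
  covering-chunk {p} (i , ℓ , e , Pi≤p , hit) = i , ℓ , e , Pi≤p , (begin-strict
    p                                ≡⟨ m+[n∸m]≡n Pi≤p ⟨
    P i + (p ∸ P i)                  <⟨ +-monoʳ-< (P i) (at⇒<length (φ ℓ) hit) ⟩
    P i + length (φ ℓ)               ≡⟨ pos-suc e ⟨
    P (suc i)                        ∎)
    where open ≤-Reasoning

  initial-partial-next-whole : ∀ {a b p ℓ i k} → InitialPartial φ w a b p ℓ → WholeChunk φ w a b i k
    → ∃[ k′ ] WholeChunk φ w a b (suc p) k′
  initial-partial-next-whole (_ , Pp<a , a<P[1+p]) (ei , a≤Pi , P[1+i]≤b)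
    with pos-cancel-< (<-≤-trans Pp<a a≤Pi)
  ... | p<i with letterAt-≤ w ei p<i
  ...   | k′ , e1+p = k′ , e1+p , <⇒≤ a<P[1+p] , ≤-trans (pos-mono (s≤s p<i)) P[1+i]≤b

  final-partial-previous-whole : ∀ {a b p ℓ i k} → FinalPartial φ w a b p ℓ → WholeChunk φ w a b i k
    → ∃[ p′ ] (p ≡ suc p′ × ∃[ k′ ] WholeChunk φ w a b p′ k′)
  final-partial-previous-whole (ep , Pp<b , b<P[1+p]) (_ , a≤Pi , P[1+i]≤b)
    with pos-cancel-< (≤-<-trans P[1+i]≤b b<P[1+p])
  ... | s≤s (s≤s {n = p′} i≤p′) with letterAt-≤ w ep (n≤1+n p′)
  ...   | k′ , ep′ = p′ , refl , k′ , ep′ , ≤-trans a≤Pi (pos-mono i≤p′) , <⇒≤ Pp<b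

  Repeats : ℕ → ℕ → ℕ → Set
  Repeats m i j = SameLetter i j × P j ≡ P i + m

  repeats⇒pos-suc : ∀ {m i j} → Repeats m i j → P (suc j) ≡ P (suc i) + m
  repeats⇒pos-suc {m} {i} {j} ((ℓ , ei , ej) , Pj) = begin
    P (suc j)                 ≡⟨ pos-suc ej ⟩
    P j + length (φ ℓ)        ≡⟨ cong (_+ length (φ ℓ)) Pj ⟩
    P i + m + length (φ ℓ)    ≡⟨ xy∙z≈xz∙y (P i) m _ ⟩
    P i + length (φ ℓ) + m    ≡⟨ cong (_+ m) (pos-suc ei) ⟨
    P (suc i) + m             ∎
    where open ≡-Reasoning

  pos-suc⇒repeats : ∀ {m i j} → SameLetter i j → P (suc j) ≡ P (suc i) + m → Repeats m i j
  pos-suc⇒repeats {m} {i} {j} ij@(ℓ , ei , ej) Psj = ij , +-cancelʳ-≡ (length (φ ℓ)) _ _ (begin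
    P j + length (φ ℓ)        ≡⟨ pos-suc ej ⟨
    P (suc j)                 ≡⟨ Psj ⟩
    P (suc i) + m             ≡⟨ cong (_+ m) (pos-suc ei) ⟩
    P i + length (φ ℓ) + m    ≡⟨ xy∙z≈xz∙y (P i) _ m ⟩
    P i + m + length (φ ℓ)    ∎)
    where open ≡-Reasoning

  EmptyChunksRepeat : ℕ → ℕ → Set
  EmptyChunksRepeat m q = ∀ {j ℓ} → letterAt w j ≡ just ℓ → length (φ ℓ) ≡ 0 → P j ≡ q
    → ∃[ i ] Repeats m i j

  Shiftable : ℕ → ℕ → Set
  Shiftable m i = (∃[ j ] Repeats m i j) × EmptyChunksRepeat m (P i + m)

module InjectiveChunks (φ : Morphism) (inj : LetterInjective φ) (w : Word) where
  open Chunks φ w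

  empty-images-same-letter : ∀ {i j k ℓ} → letterAt w i ≡ just k → letterAt w j ≡ just ℓ
    → length (φ k) ≡ 0 → length (φ ℓ) ≡ 0 → SameLetter i j
  empty-images-same-letter {j = j} {k} {ℓ} ei ej k-empty ℓ-empty =
    k , ei , subst (λ c → letterAt w j ≡ just c) (sym k≡ℓ) ej
    where
      k≡ℓ : k ≡ ℓ
      k≡ℓ = inj k ℓ (trans (length≡0⇒[] (φ k) k-empty) (sym (length≡0⇒[] (φ ℓ) ℓ-empty)))

  empty-run⇒square : ∀ {i j ℓ} → letterAt w j ≡ just ℓ → i < j → P (suc j) ≤ P i → ContainsSquare w
  empty-run⇒square {i} {suc j} e (s≤s i≤j) stall with letterAt-≤ w e (n≤1+n j)
  ... | k , ej = same-letter-suc⇒square (empty-images-same-letter ej e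
      (empty-image ej i≤j (≤-trans (pos-mono (n≤1+n (suc j))) stall))
      (empty-image e (m≤n⇒m≤1+n i≤j) stall))

  repeat-before-next⇒square : ∀ {i j c} → SameLetter i j → SameLetter (suc i) c → c ≤ j
    → P (suc j) ≤ P c → ContainsSquare w
  repeat-before-next⇒square {i} {j} {c} ij ic c≤j stall with m≤n⇒m<n∨m≡n c≤j
  ... | inj₁ c<j  = empty-run⇒square (proj₂ (proj₂ ij)) c<j stall
  ... | inj₂ refl = same-letter-suc⇒square (same-letter-trans ij (same-letter-sym ic))

  repeats-next-empty : ∀ {m i j ℓ} → Repeats m i j → EmptyChunksRepeat m (P (suc i) + m)
    → letterAt w (suc j) ≡ just ℓ → length (φ ℓ) ≡ 0 → Repeats m (suc i) (suc j) ⊎ ContainsSquare w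
  repeats-next-empty {m} {i} {j} r@(ij@(_ , ei , _) , _) empties e1+j ℓ-empty
    with empties e1+j ℓ-empty (repeats⇒pos-suc r)
  ... | d , d~1+j , P[1+j] = compare (<-cmp d (suc i))
    where
      Pd≡P[1+i] : P d ≡ P (suc i)
      Pd≡P[1+i] = +-cancelʳ-≡ m _ _ (trans (sym P[1+j]) (repeats⇒pos-suc r))
      compare : Tri (d < suc i) (d ≡ suc i) (suc i < d) → Repeats m (suc i) (suc j) ⊎ ContainsSquare w
      compare (tri≈ _ refl _) = inj₁ (d~1+j , repeats⇒pos-suc r)
      compare (tri> _ _ 1+i<d) with letterAt-≤ w (proj₁ (proj₂ d~1+j)) (<⇒≤ 1+i<d)
      ... | (_ , e1+i) = inj₁ (empty-images-same-letter e1+i e1+j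
              (empty-image e1+i ≤-refl (≤-trans (pos-mono 1+i<d) (≤-reflexive Pd≡P[1+i]))) ℓ-empty
            , repeats⇒pos-suc r)
      compare (tri< (s≤s d≤i) _ _) = inj₂ (same-letter-suc⇒square (same-letter-trans (same-letter-sym ij)
            (empty-images-same-letter ei e1+j (empty-image ei d≤i (≤-reflexive (sym Pd≡P[1+i]))) ℓ-empty)))

  repeats-next : ∀ {m i j} → Repeats m i j → Shiftable m (suc i)
    → Repeats m (suc i) (suc j) ⊎ ContainsSquare w
  repeats-next {m} {i} {j} r@(ij , _) ((c , ic@(_ , _ , ec) , Pc) , empties) with <-cmp c (suc j)
  ... | tri≈ _ refl _ = inj₁ (ic , Pc)
  ... | tri< c<1+j _ _ = inj₂ (repeat-before-next⇒square ij ic (≤-pred c<1+j)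
          (≤-reflexive (trans (repeats⇒pos-suc r) (sym Pc))))
  ... | tri> _ _ 1+j<c with letterAt-≤ w ec (<⇒≤ 1+j<c)
  ...   | (_ , e1+j) = repeats-next-empty r empties e1+j (empty-image e1+j ≤-refl
          (≤-trans (pos-mono 1+j<c) (≤-reflexive (trans Pc (sym (repeats⇒pos-suc r))))))

  repeats⇒square : ∀ {m a b} → a < b → Repeats m a b → (∀ x → a < x → x < b → Shiftable m x)
    → ContainsSquare w
  repeats⇒square {m} {a} {b} a<b r shiftable = result
    where
      RepeatsUpTo : ℕ → Set
      RepeatsUpTo k = ∀ j → j ≤ k → Repeats m (j + a) (j + b)

      extend : ∀ {k} → RepeatsUpTo k → Repeats m (suc k + a) (suc k + b) → RepeatsUpTo (suc k)
      extend {k} rs r′ j j≤1+k with m≤n⇒m<n∨m≡n j≤1+k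
      ... | inj₁ j<1+k = rs j (≤-pred j<1+k)
      ... | inj₂ refl  = r′

      run : ∀ k → k + a < b → RepeatsUpTo k ⊎ ContainsSquare w
      run zero _ = inj₁ λ { zero _ → r ; (suc _) () }
      run (suc k) 1+k+a<b with run k (<-trans (n<1+n (k + a)) 1+k+a<b)
      ... | inj₂ square = inj₂ square
      ... | inj₁ rs with repeats-next (rs k ≤-refl) (shiftable (suc (k + a)) (s≤s (m≤n+m a k)) 1+k+a<b)
      ...   | inj₂ square = inj₂ square
      ...   | inj₁ r′     = inj₁ (extend rs r′)

      result : ContainsSquare w
      result with m≤n⇒∃[o]m+o≡n a<b
      ... | n , 1+a+n≡b with run n (≤-reflexive (trans (cong suc (+-comm n a)) 1+a+n≡b))
      ...   | inj₂ square = square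
      ...   | inj₁ rs = a , suc n , s≤s z≤n , λ k k<1+n →
                subst₂ SameLetter (+-comm k a) (sym (a+[1+n]+k≡k+b k)) (proj₁ (rs k (≤-pred k<1+n)))
        where
          a+[1+n]+k≡k+b : ∀ k → a + suc n + k ≡ k + b
          a+[1+n]+k≡k+b k = trans (cong (_+ k) (trans (+-suc a n) 1+a+n≡b)) (+-comm b k)

module SquareHalves (φ : Morphism) (inj : LetterInjective φ) (w : Word) (s m : ℕ) (0<m : 0 < m)
                    (same-decomposition : SameChunkDecomposition φ w s (s + m) m) where
  open Chunks φ w
  open InjectiveChunks φ inj w

  WholeInFirst WholeInSecond : ℕ → ℕ → Set
  WholeInFirst  = WholeChunk φ w s (s + m)
  WholeInSecond = WholeChunk φ w (s + m) (s + m + m)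

  whole-first-repeated : ∀ {i ℓ} → WholeInFirst i ℓ → ∃[ j ] (WholeInSecond j ℓ × Repeats m i j)
  whole-first-repeated {i} {ℓ} wi@(ei , s≤Pi , _) with proj₁ same-decomposition i ℓ wi
  ... | j , wj@(ej , s+m≤Pj , _) , offsets =
    j , wj , (ℓ , ei , ej) , same-offset⇒shifted s≤Pi s+m≤Pj offsets

  whole-second-repeats : ∀ {j ℓ} → WholeInSecond j ℓ → ∃[ i ] (WholeInFirst i ℓ × Repeats m i j)
  whole-second-repeats {j} {ℓ} wj@(ej , s+m≤Pj , _) with proj₂ same-decomposition j ℓ wj
  ... | i , wi@(ei , s≤Pi , _) , offsets =
    i , wi , (ℓ , ei , ej) , same-offset⇒shifted s≤Pi s+m≤Pj (sym offsets)

  empty-chunks-repeat : ∀ {q} → s ≤ q → q ≤ s + m → EmptyChunksRepeat m (q + m)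
  empty-chunks-repeat {q} s≤q q≤s+m {j} ej ℓ-empty Pj≡q+m =
    map₂ proj₂ (whole-second-repeats (ej , s+m≤Pj , P[1+j]≤s+m+m))
    where
      s+m≤Pj : s + m ≤ P j
      s+m≤Pj = subst (s + m ≤_) (sym Pj≡q+m) (+-monoˡ-≤ m s≤q)
      P[1+j]≤s+m+m : P (suc j) ≤ s + m + m
      P[1+j]≤s+m+m = begin
        P (suc j)  ≡⟨ trans (pos-suc ej) (trans (cong (P j +_) ℓ-empty) (+-identityʳ (P j))) ⟩
        P j        ≡⟨ Pj≡q+m ⟩
        q + m      ≤⟨ +-monoˡ-≤ m q≤s+m ⟩
        s + m + m  ∎
        where open ≤-Reasoning

  shiftable-in-first-half : ∀ {x} → s ≤ P x → P x ≤ s + m → ∃[ j ] Repeats m x j → Shiftable m x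
  shiftable-in-first-half s≤Px Px≤s+m repeated = repeated , empty-chunks-repeat s≤Px Px≤s+m

  whole-first-shiftable : ∀ {x ℓ} → WholeInFirst x ℓ → Shiftable m x
  whole-first-shiftable {x} wx@(_ , s≤Px , P[1+x]≤s+m) = shiftable-in-first-half s≤Px
    (≤-trans (pos-mono (n≤1+n x)) P[1+x]≤s+m) (map₂ proj₂ (whole-first-repeated wx))

  repeats-over-first-half⇒square : ∀ {a b} → Repeats m a b → s ≤ P (suc a) → P b ≤ s + m
    → ContainsSquare w
  repeats-over-first-half⇒square {a} {b} r@((_ , _ , eb) , Pb≡Pa+m) s≤P[1+a] Pb≤s+m =
    repeats⇒square a<b r interior-shiftable
    where
      a<b : a < b
      a<b = pos-cancel-< (subst (P a <_) (sym Pb≡Pa+m) (m<m+n (P a) 0<m))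
      interior-shiftable : ∀ x → a < x → x < b → Shiftable m x
      interior-shiftable x a<x x<b with letterAt-≤ w eb (<⇒≤ x<b)
      ... | _ , ex = whole-first-shiftable
        (ex , ≤-trans s≤P[1+a] (pos-mono a<x) , ≤-trans (pos-mono x<b) Pb≤s+m)

  whole-chunk-at-middle⇒square : ∀ {c ℓ} → letterAt w c ≡ just ℓ → P c ≡ s + m
    → P (suc c) ≤ s + m + m → ContainsSquare w
  whole-chunk-at-middle⇒square ec Pc≡s+m P[1+c]≤s+m+m
    with whole-second-repeats (ec , ≤-reflexive (sym Pc≡s+m) , P[1+c]≤s+m+m)
  ... | a , (_ , s≤Pa , _) , r =
    repeats-over-first-half⇒square r (≤-trans s≤Pa (pos-mono (n≤1+n a))) (≤-reflexive Pc≡s+m)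

  initial-partials⇒square : HasWholeChunk φ w s (s + m) → HasWholeChunk φ w (s + m) (s + m + m)
    → InitialPartialsSameLetter φ w s (s + m) m → ContainsSquare w
  initial-partials⇒square (_ , _ , wi) (_ , _ , wj)
    (p , q , ℓ , pp@(ep , Pp<s , s<P[1+p]) , qq@(eq , Pq<s+m , _)) =
    repeats-over-first-half⇒square (pos-suc⇒repeats (ℓ , ep , eq) (≤-antisym upper lower))
      (<⇒≤ s<P[1+p]) (<⇒≤ Pq<s+m)
    where
      upper : P (suc q) ≤ P (suc p) + m
      upper with whole-first-repeated (proj₂ (initial-partial-next-whole pp wi))
      ... | c , (_ , s+m≤Pc , _) , (_ , Pc≡) =
        ≤-trans (pos-mono (pos-cancel-< {q} {c} (<-≤-trans Pq<s+m s+m≤Pc))) (≤-reflexive Pc≡)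
      lower : P (suc p) + m ≤ P (suc q)
      lower with whole-second-repeats (proj₂ (initial-partial-next-whole qq wj))
      ... | d , (_ , s≤Pd , _) , (_ , P[1+q]≡) =
        ≤-trans (+-monoˡ-≤ m (pos-mono (pos-cancel-< {p} {d} (<-≤-trans Pp<s s≤Pd)))) (≤-reflexive (sym P[1+q]≡))

  final-partials⇒square : HasWholeChunk φ w s (s + m) → HasWholeChunk φ w (s + m) (s + m + m)
    → FinalPartialsSameLetter φ w s (s + m) m → ContainsSquare w
  final-partials⇒square (_ , _ , wi) (_ , _ , wj)
    (p , q , ℓ , pp@(ep , Pp<s+m , s+m<P[1+p]) , qq@(eq , _ , s+m+m<P[1+q]))
    with whole-second-repeats (proj₂ (initial-partial-next-whole pp wj))
  ... | a , (_ , s≤Pa , _) , ra@(_ , P[1+p]≡Pa+m) = repeats⇒square a<1+p ra interior-shiftable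
    where
      a<1+p : a < suc p
      a<1+p = pos-cancel-< (subst (P a <_) (sym P[1+p]≡Pa+m) (m<m+n (P a) 0<m))
      upper : P q ≤ P p + m
      upper with final-partial-previous-whole qq wj
      ... | q′ , refl , _ , wq′ with whole-second-repeats wq′
      ...   | d , (_ , _ , P[1+d]≤s+m) , rd = ≤-trans (≤-reflexive (repeats⇒pos-suc rd))
              (+-monoˡ-≤ m (pos-mono (≤-pred (pos-cancel-< {suc d} {suc p} (≤-<-trans P[1+d]≤s+m s+m<P[1+p])))))
      lower : P p + m ≤ P q
      lower with final-partial-previous-whole pp wi
      ... | p′ , refl , _ , wp′ with whole-first-repeated wp′
      ...   | c , (_ , _ , P[1+c]≤s+m+m) , rc = ≤-trans (≤-reflexive (sym (repeats⇒pos-suc rc)))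
              (pos-mono (≤-pred (pos-cancel-< {suc c} {suc q} (≤-<-trans P[1+c]≤s+m+m s+m+m<P[1+q]))))
      interior-shiftable : ∀ x → a < x → x < suc p → Shiftable m x
      interior-shiftable x a<x x<1+p with m≤n⇒m<n∨m≡n (≤-pred x<1+p)
      ... | inj₂ refl = shiftable-in-first-half (≤-trans s≤Pa (pos-mono (≤-pred a<1+p))) (<⇒≤ Pp<s+m)
            (q , (ℓ , ep , eq) , ≤-antisym upper lower)
      ... | inj₁ x<p with letterAt-≤ w ep (<⇒≤ x<p)
      ...   | _ , ex = whole-first-shiftable
              (ex , ≤-trans s≤Pa (pos-mono (<⇒≤ a<x)) , ≤-trans (pos-mono x<p) (<⇒≤ Pp<s+m))

theorem2p2 : (φ : Morphism) → LetterInjective φ → (∀ ℓ → SquareFree (φ ℓ))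
    → (w : Word) → (s m : ℕ) → SquareOcc φ w s m
    → HasWholeChunk φ w s (s + m) × HasWholeChunk φ w (s + m) (s + m + m)
    → SameChunkDecomposition φ w s (s + m) m
    → (HasPartial φ w s (s + m) ⊎ HasPartial φ w (s + m) (s + m + m)
       → InitialPartialsSameLetter φ w s (s + m) m ⊎ FinalPartialsSameLetter φ w s (s + m) m)
    → ContainsSquare w
theorem2p2 φ inj _ w s m (0<m , occurrence) (whole₁ , whole₂) same-decomposition partials-agree =
  by-middle-chunk middle-chunk
  where
    open Chunks φ w
    open SquareHalves φ inj w s m 0<m same-decomposition

    by-partials : HasPartial φ w s (s + m) ⊎ HasPartial φ w (s + m) (s + m + m) → ContainsSquare w
    by-partials partial = [ initial-partials⇒square whole₁ whole₂ , final-partials⇒square whole₁ whole₂ ]′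
                            (partials-agree partial)

    middle-chunk : ∃[ c ] ∃[ ℓ ] (letterAt w c ≡ just ℓ × P c ≤ s + m × s + m < P (suc c))
    middle-chunk with occurrence 0 0<m
    ... | letter , _ , image = covering-chunk (subst (λ p → ImgAt φ w p letter) (+-identityʳ (s + m)) image)

    by-middle-chunk : ∃[ c ] ∃[ ℓ ] (letterAt w c ≡ just ℓ × P c ≤ s + m × s + m < P (suc c))
      → ContainsSquare w
    by-middle-chunk (c , ℓ , ec , Pc≤s+m , s+m<P[1+c]) with m≤n⇒m<n∨m≡n Pc≤s+m | s + m + m <? P (suc c)
    ... | inj₁ Pc<s+m | _ = by-partials (inj₁ (c , ℓ , inj₂ (ec , Pc<s+m , s+m<P[1+c])))
    ... | inj₂ Pc≡s+m | yes s+m+m<P[1+c] = by-partials (inj₂ (c , ℓ , inj₂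
          (ec , subst (_< s + m + m) (sym Pc≡s+m) (m<m+n (s + m) 0<m) , s+m+m<P[1+c])))
    ... | inj₂ Pc≡s+m | no s+m+m≮P[1+c] = whole-chunk-at-middle⇒square ec Pc≡s+m (≮⇒≥ s+m+m≮P[1+c])
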